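{- Let $G$ be a graph on $n \geq 5$ vertices such that $N(v_1) \neq N(v_2)$ for any two distinct non-adjacent vertices $v_1, v_2$. Then every edge of $G$ that is not contained in any triangle is necessary.
   Context: Graphs are finite, simple, connected and labeled. $N(v)$ is the set of neighbors of $v$. $T_3(G)$ is the set of 3-element subsets of $V(G)$ inducing a connected subgraph of $G$. An edge $uv \in E(G)$ is necessary if there is no graph $H$ (on the same vertex set) with $uv \notin E(H)$ and $T_3(H) = T_3(G)$. -}

module Defs where

open import Data.Nat using (ℕ; zero; suc)
open import Data.Fin using (Fin)
open import Data.Bool using (Bool; true; false)
open import Data.Unit using (⊤)
open import Data.Sum using (_⊎_)
open import Data.Product using (Σ; _×_; _,_; ∃)
open import Relation.Binary.PropositionalEquality using (_≡_; _≢_)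
open import Relation.Nullary using (¬_)
open import Function.Bundles using (_⇔_)

record SimpleGraph (n : ℕ) : Set where
  field
    adj   : Fin n → Fin n → Bool
    sym   : ∀ u v → adj u v ≡ adj v u
    irrefl : ∀ v → adj v v ≡ false
open SimpleGraph public

Edge : ∀ {n} → SimpleGraph n → Fin n → Fin n → Set
Edge G u v = adj G u v ≡ true

data WalkIn {n} (G : SimpleGraph n) (S : Fin n → Set) : Fin n → Fin n → Set where
  here : ∀ {v} → S v → WalkIn G S v v
  step : ∀ {u w v} → S u → Edge G u w → WalkIn G S w v → WalkIn G S u v

InducesConnected : ∀ {n} → SimpleGraph n → (Fin n → Set) → Set
InducesConnected G S = ∀ u v → S u → S v → WalkIn G S u v

Connected : ∀ {n} → SimpleGraph n → Set
Connected G = ∀ u v → WalkIn G (λ _ → ⊤) u v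

-- A graph in the sense of the paper: finite, simple, connected, labeled.
record Graph (n : ℕ) : Set where
  field
    graph     : SimpleGraph n
    connected : Connected graph
open Graph public

Triple : ∀ {n} → Fin n → Fin n → Fin n → Fin n → Set
Triple a b c x = x ≡ a ⊎ (x ≡ b ⊎ x ≡ c)

Distinct3 : ∀ {n} → Fin n → Fin n → Fin n → Set
Distinct3 a b c = a ≢ b × (a ≢ c × b ≢ c)

InT3 : ∀ {n} → Graph n → Fin n → Fin n → Fin n → Set
InT3 G a b c = Distinct3 a b c × InducesConnected (graph G) (Triple a b c)

SameT3 : ∀ {n} → Graph n → Graph n → Set
SameT3 G H = ∀ a b c → InT3 G a b c ⇔ InT3 H a b c

Necessary : ∀ {n} → Graph n → Fin n → Fin n → Set
Necessary {n} G u v =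
  ¬ (Σ (Graph n) λ H → ¬ Edge (graph H) u v × SameT3 H G)

SameNeighbourhood : ∀ {n} → SimpleGraph n → Fin n → Fin n → Set
SameNeighbourhood G v₁ v₂ = ∀ w → Edge G v₁ w ⇔ Edge G v₂ w

InTriangle : ∀ {n} → SimpleGraph n → Fin n → Fin n → Set
InTriangle G u v = ∃ λ w → Edge G u w × Edge G v w

-- Let uv be an edge of G in no triangle and H a graph with the same connected
-- triples but without uv. Comparing {u,v,w} in G and H shows that every other
-- neighbour w of u is adjacent in H to both u and v; comparing {v,w,w′} then
-- shows that u has at most one neighbour besides v, and likewise for v. As G
-- is connected and n ≥ 3, one of them, say u, has such a neighbour a. A few
-- more triple comparisons show that every vertex other than u, v, a is a
-- neighbour of v, or a neighbour of a but of neither u nor v, that there is at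
-- most one such vertex, and that no edge leaves {u, v, a} together with it.
-- By connectivity this set contains every vertex, so n ≤ 4.
module Submission where

open import Defs
open import Data.Nat using (ℕ; _≤_; _<_; s≤s; z≤n)
open import Data.Nat.Properties using (≤-trans; <⇒≱; n≤1+n)
open import Data.Fin using (Fin; _≟_)
open import Data.Fin.Properties using (injective⇒≤; ¬∀⟶∃¬)
open import Data.Bool using (true)
open import Data.Bool.Properties using () renaming (_≟_ to _≟ᵇ_)
open import Data.List using (List; []; _∷_; length)
open import Data.List.Relation.Unary.Any using (here; there)
open import Data.List.Membership.Propositional using (_∈_; _∉_)
open import Data.List.Membership.Setoid.Properties using (index-injective)
import Data.List.Membership.DecPropositional as DecMembership
open import Data.Empty using (⊥; ⊥-elim)
open import Data.Sum using (_⊎_; inj₁; inj₂)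
open import Data.Product using (_×_; _,_; ∃; ∃₂; proj₁; proj₂)
open import Relation.Binary.PropositionalEquality as ≡ using (_≡_; _≢_; refl; ≢-sym)
open import Relation.Nullary using (¬_; Dec; yes; no; contradiction)
open import Relation.Unary using (Decidable)
open import Function.Bundles using (Equivalence)

infix 4 _∈?_

_∈?_ : ∀ {n} (x : Fin n) (xs : List (Fin n)) → Dec (x ∈ xs)
_∈?_ = DecMembership._∈?_ _≟_

covering⇒≤length : ∀ {n} (xs : List (Fin n)) → (∀ y → y ∈ xs) → n ≤ length xs
covering⇒≤length xs ∈xs =
  injective⇒≤ (λ {y} {z} → index-injective (≡.setoid _) (∈xs y) (∈xs z))

length<⇒∃∉ : ∀ {n} (xs : List (Fin n)) → length xs < n → ∃ λ y → y ∉ xs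
length<⇒∃∉ {n} xs len<n =
  ¬∀⟶∃¬ n (_∈ xs) (_∈? xs) (λ ∈xs → <⇒≱ len<n (covering⇒≤length xs ∈xs))

module SimpleGraphProperties {n : ℕ} (G : SimpleGraph n) where

  edge-sym : ∀ {x y} → Edge G x y → Edge G y x
  edge-sym {x} {y} e = ≡.trans (SimpleGraph.sym G y x) e

  edge⇒≢ : ∀ {x y} → Edge G x y → x ≢ y
  edge⇒≢ {x} e refl = contradiction (≡.trans (≡.sym e) (irrefl G x)) λ ()

  _~?_ : ∀ x y → Dec (Edge G x y)
  x ~? y = adj G x y ≟ᵇ true

  module _ {S : Fin n → Set} where

    _▻_ : ∀ {x y z} → WalkIn G S x y → WalkIn G S y z → WalkIn G S x z
    here _     ▻ q = q
    step s e p ▻ q = step s e (p ▻ q)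

    walk-source : ∀ {x y} → WalkIn G S x y → S x
    walk-source (here s)     = s
    walk-source (step s _ _) = s

    first-step : ∀ {x y} → WalkIn G S x y → x ≢ y → ∃ λ w → S w × Edge G x w
    first-step (here _)             x≢x = ⊥-elim (x≢x refl)
    first-step (step {w = w} _ e p) _   = w , walk-source p , e

    walk-mono : ∀ {S′ : Fin n → Set} → (∀ {x} → S x → S′ x)
              → ∀ {x y} → WalkIn G S x y → WalkIn G S′ x y
    walk-mono S⊆S′ (here s)     = here (S⊆S′ s)
    walk-mono S⊆S′ (step s e p) = step (S⊆S′ s) e (walk-mono S⊆S′ p)

    walk⇒boundary-edge : ∀ {P : Fin n → Set} → Decidable P → ∀ {x y} → WalkIn G S x y
                       → P x → ¬ P y → ∃₂ λ x′ y′ → P x′ × ¬ P y′ × Edge G x′ y′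
    walk⇒boundary-edge P? (here _) Px ¬Py = ⊥-elim (¬Py Px)
    walk⇒boundary-edge P? (step {w = w} _ e p) Px ¬Py with P? w
    ... | yes Pw = walk⇒boundary-edge P? p Pw ¬Py
    ... | no ¬Pw = _ , _ , Px , ¬Pw , e

    walk-preserves : ∀ {P : Fin n → Set} → (∀ {x y} → P x → Edge G x y → P y)
                   → ∀ {x y} → WalkIn G S x y → P x → P y
    walk-preserves closed (here _)     Px = Px
    walk-preserves closed (step _ e p) Px = walk-preserves closed p (closed Px e)

  ConnectedTriple : Fin n → Fin n → Fin n → Set
  ConnectedTriple a b c = InducesConnected G (Triple a b c)

  path⇒connected : ∀ {a b c} → Edge G a b → Edge G b c → ConnectedTriple a b c
  path⇒connected {a} {b} {c} ab bc _ _ x∈ y∈ = to-b x∈ ▻ from-b y∈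
    where
      to-b : ∀ {x} → Triple a b c x → WalkIn G (Triple a b c) x b
      to-b (inj₁ refl)        = step (inj₁ refl) ab (here (inj₂ (inj₁ refl)))
      to-b (inj₂ (inj₁ refl)) = here (inj₂ (inj₁ refl))
      to-b (inj₂ (inj₂ refl)) = step (inj₂ (inj₂ refl)) (edge-sym bc) (here (inj₂ (inj₁ refl)))

      from-b : ∀ {y} → Triple a b c y → WalkIn G (Triple a b c) b y
      from-b (inj₁ refl)        = step (inj₂ (inj₁ refl)) (edge-sym ab) (here (inj₁ refl))
      from-b (inj₂ (inj₁ refl)) = here (inj₂ (inj₁ refl))
      from-b (inj₂ (inj₂ refl)) = step (inj₂ (inj₁ refl)) bc (here (inj₂ (inj₂ refl)))

  connected⇒edge : ∀ {a b c} → a ≢ b → ConnectedTriple a b c → ¬ Edge G a b → Edge G a c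
  connected⇒edge a≢b conn ¬ab with first-step (conn _ _ (inj₁ refl) (inj₂ (inj₁ refl))) a≢b
  ... | _ , inj₁ refl        , aa = ⊥-elim (edge⇒≢ aa refl)
  ... | _ , inj₂ (inj₁ refl) , ab = ⊥-elim (¬ab ab)
  ... | _ , inj₂ (inj₂ refl) , ac = ac

  connected-swap₁₂ : ∀ {a b c} → ConnectedTriple a b c → ConnectedTriple b a c
  connected-swap₁₂ conn x y x∈ y∈ = walk-mono swap₁₂ (conn x y (swap₁₂ x∈) (swap₁₂ y∈))
    where
      swap₁₂ : ∀ {a b c x} → Triple a b c x → Triple b a c x
      swap₁₂ (inj₁ e)        = inj₂ (inj₁ e)
      swap₁₂ (inj₂ (inj₁ e)) = inj₁ e
      swap₁₂ (inj₂ (inj₂ e)) = inj₂ (inj₂ e)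

edge-closed⇒universal : ∀ {n} (G : Graph n) {P : Fin n → Set}
                      → (∀ {x y} → P x → Edge (graph G) x y → P y)
                      → ∀ {x} → P x → ∀ y → P y
edge-closed⇒universal G closed {x} Px y =
  SimpleGraphProperties.walk-preserves (graph G) closed (connected G x y) Px

module EdgeRemoval {n : ℕ} (G H : Graph n) (sameT3 : SameT3 H G) where

  module InG = SimpleGraphProperties (graph G)
  module InH = SimpleGraphProperties (graph H)

  infix 4 _~ᴳ_ _~ᴴ_

  _~ᴳ_ _~ᴴ_ : Fin n → Fin n → Set
  _~ᴳ_ = Edge (graph G)
  _~ᴴ_ = Edge (graph H)

  transfer : ∀ {a b c} → Distinct3 a b c → InG.ConnectedTriple a b c → InH.ConnectedTriple a b c
  transfer d conn = proj₂ (Equivalence.from (sameT3 _ _ _) (d , conn))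

  transfer⁻¹ : ∀ {a b c} → Distinct3 a b c → InH.ConnectedTriple a b c → InG.ConnectedTriple a b c
  transfer⁻¹ d conn = proj₂ (Equivalence.to (sameT3 _ _ _) (d , conn))

  record RemovedEdge (u v : Fin n) : Set where
    field
      uv∈G          : u ~ᴳ v
      uv∉H          : ¬ u ~ᴴ v
      triangle-free : ¬ InTriangle (graph G) u v

  reverse : ∀ {u v} → RemovedEdge u v → RemovedEdge v u
  reverse r = record
    { uv∈G          = InG.edge-sym uv∈G
    ; uv∉H          = λ vu → uv∉H (InH.edge-sym vu)
    ; triangle-free = λ { (w , vw , uw) → triangle-free (w , uw , vw) }
    }
    where open RemovedEdge r

  module Neighbours {u v : Fin n} (r : RemovedEdge u v) where
    open RemovedEdge r

    u≢v : u ≢ v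
    u≢v = InG.edge⇒≢ uv∈G

    ¬common-neighbour : ∀ {w} → u ~ᴳ w → ¬ v ~ᴳ w
    ¬common-neighbour uw vw = triangle-free (_ , uw , vw)

    non-neighbour-of-v⇒≢u : ∀ {x} → ¬ v ~ᴳ x → x ≢ u
    non-neighbour-of-v⇒≢u ¬vx refl = ¬vx (InG.edge-sym uv∈G)

    neighbour-joined-in-H : ∀ {w} → w ≢ v → u ~ᴳ w → u ~ᴴ w × v ~ᴴ w
    neighbour-joined-in-H w≢v uw =
        InH.connected⇒edge u≢v (InH.connected-swap₁₂ vuw) uv∉H
      , InH.connected⇒edge (≢-sym u≢v) vuw (λ vu → uv∉H (InH.edge-sym vu))
      where
        vuw : InH.ConnectedTriple v u _
        vuw = transfer (≢-sym u≢v , ≢-sym w≢v , InG.edge⇒≢ uw)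
                       (InG.path⇒connected (InG.edge-sym uv∈G) uw)

    neighbour-unique : ∀ {a a′} → a ≢ v → a′ ≢ v → u ~ᴳ a → u ~ᴳ a′ → a ≡ a′
    neighbour-unique {a} {a′} a≢v a′≢v ua ua′ with a ≟ a′
    ... | yes a≡a′ = a≡a′
    ... | no a≢a′  = ⊥-elim (¬common-neighbour ua′
          (InG.connected⇒edge (≢-sym a≢v) (InG.connected-swap₁₂ ava′) (¬common-neighbour ua)))
      where
        ava′ : InG.ConnectedTriple a v a′
        ava′ = transfer⁻¹ (a≢v , a≢a′ , ≢-sym a′≢v)
                 (InH.path⇒connected (InH.edge-sym (proj₂ (neighbour-joined-in-H a≢v ua)))
                                     (proj₂ (neighbour-joined-in-H a′≢v ua′)))

    second-neighbour-in-H : ∀ {a c} → u ~ᴳ a → a ≢ v → c ≢ u → c ≢ v → a ~ᴳ c → ¬ v ~ᴳ c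
                          → ¬ a ~ᴴ c × u ~ᴴ c
    second-neighbour-in-H {a} {c} ua a≢v c≢u c≢v ac ¬vc = ¬ac-in-H , uc-in-H
      where
        ¬ac-in-H : ¬ a ~ᴴ c
        ¬ac-in-H acᴴ = ¬vc (InG.connected⇒edge (≢-sym a≢v)
          (transfer⁻¹ (≢-sym a≢v , ≢-sym c≢v , InG.edge⇒≢ ac)
            (InH.path⇒connected (proj₂ (neighbour-joined-in-H a≢v ua)) acᴴ))
          (¬common-neighbour ua))

        uc-in-H : u ~ᴴ c
        uc-in-H = InH.edge-sym (InH.connected⇒edge (≢-sym (InG.edge⇒≢ ac))
          (transfer (≢-sym (InG.edge⇒≢ ac) , c≢u , ≢-sym (InG.edge⇒≢ ua))
            (InG.path⇒connected (InG.edge-sym ac) (InG.edge-sym ua)))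
          (λ caᴴ → ¬ac-in-H (InH.edge-sym caᴴ)))

    second-neighbour-unique : ∀ {a c d} → u ~ᴳ a → a ≢ v → c ≢ u → c ≢ v → d ≢ u → d ≢ v
                            → a ~ᴳ c → a ~ᴳ d → ¬ v ~ᴳ c → ¬ v ~ᴳ d → c ≡ d
    second-neighbour-unique {a} {c} {d} ua a≢v c≢u c≢v d≢u d≢v ac ad ¬vc ¬vd with c ≟ d
    ... | yes c≡d = c≡d
    ... | no c≢d  = ⊥-elim (¬ad-in-H
          (InH.connected⇒edge (InG.edge⇒≢ ac) (InH.connected-swap₁₂ cad) ¬ac-in-H))
      where
        ¬ac-in-H : ¬ a ~ᴴ c
        ¬ac-in-H = proj₁ (second-neighbour-in-H ua a≢v c≢u c≢v ac ¬vc)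

        ¬ad-in-H : ¬ a ~ᴴ d
        ¬ad-in-H = proj₁ (second-neighbour-in-H ua a≢v d≢u d≢v ad ¬vd)

        cad : InH.ConnectedTriple c a d
        cad = transfer (≢-sym (InG.edge⇒≢ ac) , c≢d , InG.edge⇒≢ ad)
                       (InG.path⇒connected (InG.edge-sym ac) ad)

    no-third-layer : ∀ {a c d} → u ~ᴳ a → a ≢ v → c ≢ u → c ≢ v → d ≢ u → d ≢ a
                   → a ~ᴳ c → c ~ᴳ d → ¬ u ~ᴳ c → ¬ v ~ᴳ c → ¬ u ~ᴳ d → ⊥
    no-third-layer {a} {c} {d} ua a≢v c≢u c≢v d≢u d≢a ac cd ¬uc ¬vc ¬ud =
      ¬cd-in-H (InH.connected⇒edge (≢-sym (InG.edge⇒≢ ac)) (InH.connected-swap₁₂ acd)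
                                   (λ caᴴ → ¬ac-in-H (InH.edge-sym caᴴ)))
      where
        ¬ac-in-H : ¬ a ~ᴴ c
        ¬ac-in-H = proj₁ (second-neighbour-in-H ua a≢v c≢u c≢v ac ¬vc)

        uc-in-H : u ~ᴴ c
        uc-in-H = proj₂ (second-neighbour-in-H ua a≢v c≢u c≢v ac ¬vc)

        ¬cd-in-H : ¬ c ~ᴴ d
        ¬cd-in-H cdᴴ = ¬ud (InG.connected⇒edge (≢-sym c≢u)
          (transfer⁻¹ (≢-sym c≢u , ≢-sym d≢u , InG.edge⇒≢ cd) (InH.path⇒connected uc-in-H cdᴴ))
          ¬uc)

        acd : InH.ConnectedTriple a c d
        acd = transfer (InG.edge⇒≢ ac , ≢-sym d≢a , InG.edge⇒≢ cd) (InG.path⇒connected ac cd)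

  module BothSides {u v : Fin n} (r : RemovedEdge u v) where
    open Neighbours r public
    private module Opposite = Neighbours (reverse r)

    opposite-neighbour-excludes-second-neighbour :
      ∀ {a b c} → u ~ᴳ a → a ≢ v → v ~ᴳ b → b ≢ u → c ≢ u → c ≢ v → c ≢ b
      → a ~ᴳ c → ¬ u ~ᴳ c → ¬ v ~ᴳ c → ⊥
    opposite-neighbour-excludes-second-neighbour {a} {b} {c} ua a≢v vb b≢u c≢u c≢v c≢b ac ¬uc ¬vc =
      Opposite.¬common-neighbour vb (InG.connected⇒edge (≢-sym c≢u) (InG.connected-swap₁₂ cub) ¬uc)
      where
        cub : InG.ConnectedTriple c u b
        cub = transfer⁻¹ (c≢u , c≢b , ≢-sym b≢u)
          (InH.path⇒connected (InH.edge-sym (proj₂ (second-neighbour-in-H ua a≢v c≢u c≢v ac ¬vc)))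
                              (proj₂ (Opposite.neighbour-joined-in-H b≢u vb)))

  module FixedNeighbour {u v : Fin n} (r : RemovedEdge u v) {a : Fin n} (ua : u ~ᴳ a) (a≢v : a ≢ v) where
    open BothSides r
    private module Opposite = BothSides (reverse r)

    Fourth : Fin n → Set
    Fourth x = (x ≢ u × v ~ᴳ x) ⊎ (¬ u ~ᴳ x × ¬ v ~ᴳ x × a ~ᴳ x)

    Near : Fin n → Set
    Near x = x ≡ u ⊎ x ≡ v ⊎ x ≡ a ⊎ Fourth x

    fourth-unique : ∀ {x y} → Fourth x → Fourth y → x ≡ y
    fourth-unique (inj₁ (x≢u , vx)) (inj₁ (y≢u , vy)) = Opposite.neighbour-unique x≢u y≢u vx vy
    fourth-unique (inj₁ (x≢u , vx)) (inj₂ (¬uy , ¬vy , ay)) = ⊥-elim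
      (opposite-neighbour-excludes-second-neighbour ua a≢v vx x≢u (non-neighbour-of-v⇒≢u ¬vy)
        (Opposite.non-neighbour-of-v⇒≢u ¬uy) (λ { refl → ¬vy vx }) ay ¬uy ¬vy)
    fourth-unique (inj₂ (¬ux , ¬vx , ax)) (inj₁ (y≢u , vy)) = ⊥-elim
      (opposite-neighbour-excludes-second-neighbour ua a≢v vy y≢u (non-neighbour-of-v⇒≢u ¬vx)
        (Opposite.non-neighbour-of-v⇒≢u ¬ux) (λ { refl → ¬vx vy }) ax ¬ux ¬vx)
    fourth-unique (inj₂ (¬ux , ¬vx , ax)) (inj₂ (¬uy , ¬vy , ay)) =
      second-neighbour-unique ua a≢v (non-neighbour-of-v⇒≢u ¬vx) (Opposite.non-neighbour-of-v⇒≢u ¬ux)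
        (non-neighbour-of-v⇒≢u ¬vy) (Opposite.non-neighbour-of-v⇒≢u ¬uy) ax ay ¬vx ¬vy

    classify : ∀ {y} → y ≢ u → y ≢ v → y ≢ a → Fourth y ⊎ (¬ u ~ᴳ y × ¬ v ~ᴳ y × ¬ a ~ᴳ y)
    classify {y} y≢u y≢v y≢a with v InG.~? y | u InG.~? y | a InG.~? y
    ... | yes vy | _      | _      = inj₁ (inj₁ (y≢u , vy))
    ... | no _   | yes uy | _      = ⊥-elim (y≢a (neighbour-unique y≢v a≢v uy ua))
    ... | no ¬vy | no ¬uy | yes ay = inj₁ (inj₂ (¬uy , ¬vy , ay))
    ... | no ¬vy | no ¬uy | no ¬ay = inj₂ (¬uy , ¬vy , ¬ay)

    no-edge-beyond : ∀ {x y} → Near x → x ~ᴳ y → y ≢ u → y ≢ a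
                   → ¬ u ~ᴳ y → ¬ v ~ᴳ y → ¬ a ~ᴳ y → ⊥
    no-edge-beyond (inj₁ refl)               xy _ _ ¬uy _ _ = ¬uy xy
    no-edge-beyond (inj₂ (inj₁ refl))        xy _ _ _ ¬vy _ = ¬vy xy
    no-edge-beyond (inj₂ (inj₂ (inj₁ refl))) xy _ _ _ _ ¬ay = ¬ay xy
    no-edge-beyond (inj₂ (inj₂ (inj₂ (inj₁ (x≢u , vx))))) xy y≢u y≢a ¬uy ¬vy _ =
      Opposite.opposite-neighbour-excludes-second-neighbour vx x≢u ua a≢v
        (Opposite.non-neighbour-of-v⇒≢u ¬uy) y≢u y≢a xy ¬vy ¬uy
    no-edge-beyond (inj₂ (inj₂ (inj₂ (inj₂ (¬ux , ¬vx , ax))))) xy y≢u y≢a ¬uy _ _ =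
      no-third-layer ua a≢v (non-neighbour-of-v⇒≢u ¬vx) (Opposite.non-neighbour-of-v⇒≢u ¬ux)
        y≢u y≢a ax xy ¬ux ¬vx ¬uy

    near-closed : ∀ {x y} → Near x → x ~ᴳ y → Near y
    near-closed {y = y} near-x xy with y ≟ u | y ≟ v | y ≟ a
    ... | yes y≡u | _       | _       = inj₁ y≡u
    ... | no _    | yes y≡v | _       = inj₂ (inj₁ y≡v)
    ... | no _    | no _    | yes y≡a = inj₂ (inj₂ (inj₁ y≡a))
    ... | no y≢u  | no y≢v  | no y≢a with classify y≢u y≢v y≢a
    ...   | inj₁ fourth-y           = inj₂ (inj₂ (inj₂ fourth-y))
    ...   | inj₂ (¬uy , ¬vy , ¬ay) = ⊥-elim (no-edge-beyond near-x xy y≢u y≢a ¬uy ¬vy ¬ay)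

    all-near : ∀ x → Near x
    all-near = edge-closed⇒universal G near-closed (inj₁ refl)

    fourth : ∀ {x xs} → x ∉ u ∷ v ∷ a ∷ xs → Fourth x
    fourth {x} x∉ with all-near x
    ... | inj₁ x≡u                    = ⊥-elim (x∉ (here x≡u))
    ... | inj₂ (inj₁ x≡v)             = ⊥-elim (x∉ (there (here x≡v)))
    ... | inj₂ (inj₂ (inj₁ x≡a))      = ⊥-elim (x∉ (there (there (here x≡a))))
    ... | inj₂ (inj₂ (inj₂ fourth-x)) = fourth-x

    at-most-four-vertices : ¬ 5 ≤ n
    at-most-four-vertices 5≤n
      with s  , s∉  ← length<⇒∃∉ (u ∷ v ∷ a ∷ []) (≤-trans (n≤1+n 4) 5≤n)
      with s′ , s′∉ ← length<⇒∃∉ (u ∷ v ∷ a ∷ s ∷ []) 5≤n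
      = s′∉ (there (there (there (here (≡.sym (fourth-unique (fourth s∉) (fourth s′∉)))))))

  no-removable-edge : 5 ≤ n → ∀ {u v} → ¬ RemovedEdge u v
  no-removable-edge 5≤n {u} {v} r
    with s , s∉ ← length<⇒∃∉ (u ∷ v ∷ []) (≤-trans (s≤s (s≤s (s≤s z≤n))) 5≤n)
    with InG.walk⇒boundary-edge (_∈? u ∷ v ∷ []) (connected G u s) (here refl) s∉
  ... | _ , a , here refl , a∉ , ua =
    FixedNeighbour.at-most-four-vertices r ua (λ a≡v → a∉ (there (here a≡v))) 5≤n
  ... | _ , a , there (here refl) , a∉ , va =
    FixedNeighbour.at-most-four-vertices (reverse r) va (λ a≡u → a∉ (here a≡u)) 5≤n

lemma4p9 : (n : ℕ) → 5 ≤ n → (G : Graph n)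
    → (∀ v₁ v₂ → v₁ ≢ v₂ → ¬ Edge (graph G) v₁ v₂ → ¬ SameNeighbourhood (graph G) v₁ v₂)
    → ∀ u v → Edge (graph G) u v → ¬ InTriangle (graph G) u v → Necessary G u v
lemma4p9 n 5≤n G _ u v uv∈G triangle-free (H , uv∉H , sameT3) =
  EdgeRemoval.no-removable-edge G H sameT3 5≤n
    record { uv∈G = uv∈G ; uv∉H = uv∉H ; triangle-free = triangle-free }
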